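{- Let $n\ge1$ and $N=2^n$. Then $$n\le\rho_{\mathsf{can}}(G_{\mathsf{NEQ}},\mathcal G_{N,N})\le\rho_{\mathsf{ultra}}(G_{\mathsf{NEQ}},\mathcal G_{N,N})\le\rho_{\mathsf{ultra}}(\mathsf{NEQ}_{2n}^{ -1}(1),\mathcal B_{2n})\le\mathsf{conondet}\text{ - }\mathsf{size}_\wedge(\mathsf{NEQ}_{2n})\le\mathsf{nondet}\text{ - }\mathsf{size}_\vee(\mathsf{EQ}_{2n})\le\mathsf{size}_\vee(\mathsf{EQ}_{2n})\le\mathsf{size}_\wedge(\mathsf{NEQ}_{2n})\le n.$$ In particular, $\mathsf{nondet}\text{ - }\mathsf{size}_\vee(\mathsf{EQ}_{2n})=n$.
   Context: $\mathsf{NEQ}_{2n}\colon\{0,1\}^n\times\{0,1\}^n\to\{0,1\}$ is $1$ iff $x\ne y$; $\mathsf{EQ}_{2n}=1-\mathsf{NEQ}_{2n}$. $G_{\mathsf{NEQ}}=\{(u,v)\in[N]\times[N]:u\ne v\}$. Circuits are DeMorgan circuits with fan-in two AND/OR gates over input literals (negations only at inputs). $\mathsf{size}_\wedge(f)$ / $\mathsf{size}_\vee(f)$: minimum number of AND / OR gates in such a circuit computing $f$. $\mathsf{nondet}\text{ - }\mathsf{size}_\vee(g)$: minimum number of OR gates in such a circuit $C(x,y)$ (with any number of extra inputs $y$) such that $g(x)=1$ iff $\exists y\,C(x,y)=1$. $\mathsf{conondet}\text{ - }\mathsf{size}_\wedge(f)$: minimum number of AND gates in such a circuit $D(x,y)$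 with $f(x)=1$ iff $\forall y\,D(x,y)=1$. Generators: $\mathcal G_{N,N}=\{R_1,\dots,R_N,C_1,\dots,C_N\}$ on $[N]\times[N]$, $R_i=\{(i,j):j\in[N]\}$, $C_j=\{(i,j):i\in[N]\}$; $\mathcal B_{2n}=\{B_1,\dots,B_{2n},B_1^c,\dots,B_{2n}^c\}$ on $\{0,1\}^{2n}$, $B_i=\{v:v_i=1\}$. For a ground set $\Gamma$, generators $\mathcal B$, $A\subseteq\Gamma$, $U=\Gamma\setminus A$: a semi-filter over $U$ is a nonempty family $\mathcal F\subseteq\mathcal P(U)$, $\emptyset\notin\mathcal F$, upward closed within $\mathcal P(U)$; a semi-ultra-filter additionally contains $W$ or $U\setminus W$ for every $W\subseteq U$. $\mathcal F$ is above $w$ if $B\cap U\in\mathcal F$ for each $B\in\mathcal B$ with $w\in B$. A pair $(E,H)$ of subsets of $U$ covers $\mathcal F$ if $E,H\in\mathcal F$ and $E\cap H\notin\mathcal F$. $\rho_{\mathsf{ultra}}(A,\mathcal B)$ is the minimum number of pairs covering all semi-ultra-filters over $U$ above some $a\in A$. For $G\subseteq[N]\times[N]$, $\overline G$ its complement, and $e=(u,v)\in G$: $\mathcal F_e=\{W\subseteq\overline G:R_u\cap\overline G\subseteq W\text{ or }C_v\cap\overline G\subseteq W\}$; $\rho_{\mathsf{can}}(G,\mathcal G_{N,N})$ is the minimum number of pairs of subsets of $\overline G$ covering every $\mathcal F_e$ ($e\in G$) that is a semi-filter over $\overline G$. -}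

module Defs where

open import Level using (Level; _⊔_) renaming (suc to lsuc; zero to lzero)
open import Data.Nat using (ℕ; zero; suc; _+_; _≤_; _^_)
open import Data.Fin using (Fin)
import Data.Fin as Fin
open import Data.Bool using (Bool; true; false; _∧_; _∨_; not; if_then_else_)
import Data.Bool as Bool
open import Data.Vec using (Vec; []; _∷ʳ_; lookup; take; drop; _++_)
import Data.Vec.Properties as VecP
open import Data.Product using (Σ; Σ-syntax; ∃; _×_; _,_)
open import Data.Sum using (_⊎_; inj₁; inj₂)
open import Relation.Nullary using (¬_; does)
open import Relation.Binary.PropositionalEquality using (_≡_)

IsMin : ∀ {ℓ} → (ℕ → Set ℓ) → ℕ → Set ℓ
IsMin P m = P m × (∀ k → P k → m ≤ k)

-- DeMorgan circuits: fan-in two AND/OR gates, input literals only.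
-- A circuit on m inputs with g gates is a sequence of gates; gate i may
-- read input literals and gates 0..i-1 (so the circuit is a DAG, with
-- sharing).

data Op : Set where
  AND OR : Op

data Wire (m g : ℕ) : Set where
  lit  : Fin m → Bool → Wire m g
  gate : Fin g → Wire m g

data Gates (m : ℕ) : ℕ → Set where
  []  : Gates m zero
  _▷_ : ∀ {g} → Gates m g → Op × Wire m g × Wire m g → Gates m (suc g)

record Circuit (m : ℕ) : Set where
  constructor circuit
  field
    #gates : ℕ
    gates  : Gates m #gates
    output : Wire m #gates

applyOp : Op → Bool → Bool → Bool
applyOp AND a b = a ∧ b
applyOp OR  a b = a ∨ b

evalWire : ∀ {m g} → Wire m g → Vec Bool m → Vec Bool g → Bool
evalWire (lit i b) x vs = if b then lookup x i else not (lookup x i)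
evalWire (gate j)  x vs = lookup vs j

evalGates : ∀ {m g} → Gates m g → Vec Bool m → Vec Bool g
evalGates [] x = []
evalGates (c ▷ (o , w₁ , w₂)) x =
  let vs = evalGates c x in vs ∷ʳ applyOp o (evalWire w₁ x vs) (evalWire w₂ x vs)

eval : ∀ {m} → Circuit m → Vec Bool m → Bool
eval (circuit _ gs out) x = evalWire out x (evalGates gs x)

countOpG : ∀ {m g} → Op → Gates m g → ℕ
countOpG o [] = zero
countOpG AND (c ▷ (AND , _)) = suc (countOpG AND c)
countOpG AND (c ▷ (OR  , _)) = countOpG AND c
countOpG OR  (c ▷ (AND , _)) = countOpG OR c
countOpG OR  (c ▷ (OR  , _)) = suc (countOpG OR c)

#AND #OR : ∀ {m} → Circuit m → ℕ
#AND C = countOpG AND (Circuit.gates C)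
#OR  C = countOpG OR  (Circuit.gates C)

Computes : ∀ {m} → Circuit m → (Vec Bool m → Bool) → Set
Computes C f = ∀ x → eval C x ≡ f x

-- size_∧(f) = s  iff  IsMin (SizeAND f) s
SizeAND : ∀ {m} → (Vec Bool m → Bool) → ℕ → Set
SizeAND {m} f s = Σ[ C ∈ Circuit m ] Computes C f × #AND C ≡ s

SizeOR : ∀ {m} → (Vec Bool m → Bool) → ℕ → Set
SizeOR {m} f s = Σ[ C ∈ Circuit m ] Computes C f × #OR C ≡ s

-- nondeterministic circuits with k extra inputs y (input vector x ++ y)
NondetSizeOR : ∀ {m} → (Vec Bool m → Bool) → ℕ → Set
NondetSizeOR {m} f s =
  Σ[ k ∈ ℕ ] Σ[ C ∈ Circuit (m + k) ]
    (∀ x → (f x ≡ true → Σ[ y ∈ Vec Bool k ] eval C (x ++ y) ≡ true)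
         × (Σ[ y ∈ Vec Bool k ] eval C (x ++ y) ≡ true → f x ≡ true))
    × #OR C ≡ s

ConondetSizeAND : ∀ {m} → (Vec Bool m → Bool) → ℕ → Set
ConondetSizeAND {m} f s =
  Σ[ k ∈ ℕ ] Σ[ D ∈ Circuit (m + k) ]
    (∀ x → (f x ≡ true → ∀ (y : Vec Bool k) → eval D (x ++ y) ≡ true)
         × ((∀ (y : Vec Bool k) → eval D (x ++ y) ≡ true) → f x ≡ true))
    × #AND D ≡ s

-- EQ / NEQ on {0,1}^n × {0,1}^n, input vector = x ++ y

NEQ : (n : ℕ) → Vec Bool (n + n) → Bool
NEQ n v = not (does (VecP.≡-dec Bool._≟_ (take n v) (drop n v)))

EQ : (n : ℕ) → Vec Bool (n + n) → Bool
EQ n v = not (NEQ n v)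

Subset : Set → Set
Subset Γ = Γ → Bool

module _ {Γ : Set} where

  _⊆_ : Subset Γ → Subset Γ → Set
  W ⊆ V = ∀ x → W x ≡ true → V x ≡ true

  _≐_ : Subset Γ → Subset Γ → Set
  W ≐ V = ∀ x → W x ≡ V x

  _∩_ : Subset Γ → Subset Γ → Subset Γ
  (W ∩ V) x = W x ∧ V x

  _∖_ : Subset Γ → Subset Γ → Subset Γ
  (W ∖ V) x = W x ∧ not (V x)

  ∅ : Subset Γ
  ∅ _ = false

  Family : Set₁
  Family = Subset Γ → Set

  record SemiFilter (U : Subset Γ) (F : Family) : Set₁ where
    field
      extensional : ∀ W V → W ≐ V → F W → F V
      inside      : ∀ W → F W → W ⊆ U
      nonempty    : Σ[ W ∈ Subset Γ ] F W
      no-empty    : ¬ F ∅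
      upward      : ∀ W V → F W → W ⊆ V → V ⊆ U → F V

  record SemiUltraFilter (U : Subset Γ) (F : Family) : Set₁ where
    field
      semiFilter : SemiFilter U F
      ultra      : ∀ W → W ⊆ U → F W ⊎ F (U ∖ W)

  Above : ∀ {I : Set} → (I → Subset Γ) → Subset Γ → Family → Γ → Set
  Above B U F w = ∀ i → B i w ≡ true → F (B i ∩ U)

  Covers : Subset Γ × Subset Γ → Family → Set
  Covers (E , H) F = F E × F H × ¬ F (E ∩ H)

  PairsIn : ∀ {t} → Subset Γ → (Fin t → Subset Γ × Subset Γ) → Set
  PairsIn U ps = ∀ j → let (E , H) = ps j in E ⊆ U × H ⊆ U

  -- ρ_ultra(A, B) = r  iff  IsMin (RhoUltra B A) r
  RhoUltra : ∀ {I : Set} → (I → Subset Γ) → Subset Γ → ℕ → Set₁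
  RhoUltra B A t =
    let U = (λ _ → true) ∖ A in
    Σ[ ps ∈ (Fin t → Subset Γ × Subset Γ) ]
      PairsIn U ps ×
      (∀ F → SemiUltraFilter U F → Σ[ a ∈ Γ ] (A a ≡ true × Above B U F a) →
        Σ[ j ∈ Fin t ] Covers (ps j) F)

Grid : ℕ → Set
Grid N = Fin N × Fin N

Row Col : ∀ {N} → Fin N → Subset (Grid N)
Row i (u , v) = does (u Fin.≟ i)
Col j (u , v) = does (v Fin.≟ j)

GenGrid : ∀ N → Fin N ⊎ Fin N → Subset (Grid N)
GenGrid N (inj₁ i) = Row i
GenGrid N (inj₂ j) = Col j

G-NEQ : ∀ N → Subset (Grid N)
G-NEQ N (u , v) = not (does (u Fin.≟ v))

Fcan : ∀ {N} → Subset (Grid N) → Grid N → Family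
Fcan G (u , v) W =
  let Gc = (λ _ → true) ∖ G in
  W ⊆ Gc × ((Row u ∩ Gc) ⊆ W ⊎ (Col v ∩ Gc) ⊆ W)

-- ρ_can(G, G_{N,N}) = r  iff  IsMin (RhoCan N G) r
RhoCan : ∀ N → Subset (Grid N) → ℕ → Set₁
RhoCan N G t =
  let Gc = (λ _ → true) ∖ G in
  Σ[ ps ∈ (Fin t → Subset (Grid N) × Subset (Grid N)) ]
    PairsIn Gc ps ×
    (∀ e → G e ≡ true → SemiFilter Gc (Fcan G e) →
      Σ[ j ∈ Fin t ] Covers (ps j) (Fcan G e))

-- Boolean cube {0,1}^{2n} and generators B_i (index (i, true)) and
-- B_i^c (index (i, false)).

GenCube : ∀ m → Fin m × Bool → Subset (Vec Bool m)
GenCube m (i , b) v = does (lookup v i Bool.≟ b)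

module Submission where

-- Upper bounds: NEQ is the disjunction over i of (xᵢ ∨ yᵢ) ∧ (¬xᵢ ∨ ¬yᵢ), a formula with n AND
-- gates; De Morgan duality, an unused nondeterministic input and duality again carry the bound n
-- to size_∨(EQ), nondet-size_∨(EQ) and conondet-size_∧(NEQ).  For ρ, split the diagonal
-- {(x,x)} by the j-th bit of x: a filter above an edge (a,b) contains Row a ∩ U and Col b ∩ U
-- (in the cube, the generators through the j-th coordinates of the two halves, intersected
-- with U), and these lie on opposite sides of the split for a bit j where a and b differ.
--
-- Lower bounds are fooling-set arguments over the 2ⁿ diagonal points.  For a nondeterministic
-- circuit for EQ, record the value of the left input of every OR gate on an accepted input
-- (x x, yₓ).  If x ≠ x′ gave the same record, every gate true on both accepted inputs would be
-- true on the mixed input (x x′, yₓ), which would be accepted although x ≠ x′; so 2ⁿ ≤ 2^#OR.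
-- The other circuit measures reduce to this one; for conondet-size_∧(NEQ), dualise and search
-- the finite cube of nondeterministic inputs for one that is rejected.
-- For ρ, the subsets of U containing (a,a) or (b,b) form a semi-ultra-filter above the edge
-- (a,b) (for the grid it is the canonical F_(a,b)), and any pair covering it must separate
-- (a,a) from (b,b) by its first set; so the first sets separate all 2ⁿ diagonal points.

open import Defs
open import Data.Bool using (Bool; true; false; not; _∧_; _∨_; if_then_else_)
import Data.Bool.Properties as Bool
open import Data.Fin using (Fin; _↑ˡ_; _↑ʳ_; inject₁; fromℕ)
import Data.Fin as Fin
open import Data.Fin.Properties using (2↔Bool; injective⇒≤; ¬∀⟶∃¬)
open import Data.Nat using (ℕ; zero; suc; _+_; _≤_; _^_; z≤n; s≤s)
open import Data.Nat.Properties using (≮⇒≥; <⇒≱; ^-monoʳ-<; ≤-refl; +-identityʳ)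
open import Data.Nat.Tactic.RingSolver using (solve-∀)
open import Data.Product using (Σ-syntax; ∃; _×_; _,_; proj₁; proj₂)
import Data.Product as Product
open import Data.Sum using (_⊎_; inj₁; inj₂; [_,_]′)
import Data.Sum as Sum
open import Data.Vec using (Vec; []; _∷_; _∷ʳ_; lookup; tabulate; map; _++_; take; drop)
open import Data.Vec.Properties
  using (≡-dec; ∷-injectiveˡ; ∷-injectiveʳ; ++-injective; take++drop≡id; lookup-++ˡ; lookup-++ʳ;
         lookup-map; map-∷ʳ; lookup∘tabulate; tabulate∘lookup; tabulate-cong)
import Data.Vec.Recursive as Rec
open import Data.Vec.Recursive.Properties using (↔Vec)
open import Function using (_∘_; _⇔_; mk⇔; Equivalence; _↔_; Inverse; _↣_; mk↣; Injection; Injective)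
open import Function.Construct.Composition using (_↔-∘_; _↣-∘_)
open import Function.Properties.Equivalence using () renaming (sym to ⇔-sym)
open import Function.Properties.Inverse using (↔-sym; ↔⇒↣)
open import Relation.Binary.Definitions using (DecidableEquality)
open import Relation.Binary.PropositionalEquality
open import Relation.Nullary using (¬_; Dec; yes; no; does; contradiction)
open import Relation.Nullary.Decidable using (decidable-stable)
open import Relation.Unary using (Decidable)

open Equivalence using (to; from)

variable
  A : Set
  a b c : Bool
  g k m n s t : ℕ

∧≡true⇔ : a ∧ b ≡ true ⇔ (a ≡ true × b ≡ true)
∧≡true⇔ {true}  = mk⇔ (refl ,_) proj₂
∧≡true⇔ {false} = mk⇔ (λ ()) (λ ())

∨≡true⇔ : a ∨ b ≡ true ⇔ (a ≡ true ⊎ b ≡ true)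
∨≡true⇔ {true}  = mk⇔ inj₁ (λ _ → refl)
∨≡true⇔ {false} = mk⇔ inj₂ [ (λ ()) , (λ b≡true → b≡true) ]′

not≡true⇔ : not b ≡ true ⇔ b ≢ true
not≡true⇔ {true}  = mk⇔ (λ ()) (λ b≢true → contradiction refl b≢true)
not≡true⇔ {false} = mk⇔ (λ _ ()) (λ _ → refl)

≡true-ext : (a ≡ true ⇔ b ≡ true) → a ≡ b
≡true-ext {true}          a⇔b = sym (to a⇔b refl)
≡true-ext {false} {true}  a⇔b = from a⇔b refl
≡true-ext {false} {false} _   = refl

does⇔ : {P : Set} (P? : Dec P) → does P? ≡ true ⇔ P
does⇔ (yes p) = mk⇔ (λ _ → p) (λ _ → refl)
does⇔ (no ¬p) = mk⇔ (λ ()) (λ p → contradiction p ¬p)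

not-does⇔ : {P : Set} (P? : Dec P) → not (does P?) ≡ true ⇔ (¬ P)
not-does⇔ P? = mk⇔ (λ h p → to not≡true⇔ h (from (does⇔ P?) p))
                   (λ ¬p → from not≡true⇔ (¬p ∘ to (does⇔ P?)))

-- Counting the Boolean cube

Vec↔Fin[2^n] : ∀ n → Vec Bool n ↔ Fin (2 ^ n)
Vec↔Fin[2^n] n =
  ↔-sym (Rec.Fin[m^n]↔Fin[m]^n 2 n) ↔-∘ (Rec.lift↔ n (↔-sym 2↔Bool) ↔-∘ ↔-sym (↔Vec n))

2^-cancel-≤ : 2 ^ m ≤ 2 ^ n → m ≤ n
2^-cancel-≤ 2^m≤2^n = ≮⇒≥ (λ n<m → <⇒≱ (^-monoʳ-< 2 ≤-refl n<m) 2^m≤2^n)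

cube-injective⇒≤ : (f : Vec Bool m → Vec Bool n) → Injective _≡_ _≡_ f → m ≤ n
cube-injective⇒≤ {m} {n} f f-injective = 2^-cancel-≤ (injective⇒≤ (Injection.injective embedding))
  where
  embedding : Fin (2 ^ m) ↣ Fin (2 ^ n)
  embedding = ↔⇒↣ (Vec↔Fin[2^n] n) ↣-∘ (mk↣ f-injective ↣-∘ ↔⇒↣ (↔-sym (Vec↔Fin[2^n] m)))

cube-¬∀⇒∃¬ : (P : Vec Bool k → Set) → Decidable P → ¬ (∀ y → P y) → ∃ λ y → ¬ P y
cube-¬∀⇒∃¬ {k} P P? ¬∀P =
  let i , ¬Pi = ¬∀⟶∃¬ _ (P ∘ fromFin) (P? ∘ fromFin)
                  (λ ∀P → ¬∀P (λ y → subst P (strictlyInverseʳ y) (∀P (toFin y))))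
  in fromFin i , ¬Pi
  where open Inverse (Vec↔Fin[2^n] k) renaming (to to toFin; from to fromFin)

≢⇒∃lookup≢ : DecidableEquality A → {v w : Vec A n} → v ≢ w → ∃ λ i → lookup v i ≢ lookup w i
≢⇒∃lookup≢ _≟_ {v = v} {w} v≢w =
  ¬∀⟶∃¬ _ _ (λ i → lookup v i ≟ lookup w i) (λ v≗w → v≢w (begin
    v                   ≡⟨ tabulate∘lookup v ⟨
    tabulate (lookup v) ≡⟨ tabulate-cong v≗w ⟩
    tabulate (lookup w) ≡⟨ tabulate∘lookup w ⟩
    w                   ∎))
  where open ≡-Reasoning

++-split : (x : Vec A m) (y : Vec A n) → take m (x ++ y) ≡ x × drop m (x ++ y) ≡ y
++-split {m = m} x y = ++-injective (take m (x ++ y)) x (take++drop≡id m (x ++ y))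

lookup-↑ˡ : (v : Vec A (m + n)) (j : Fin m) → lookup v (j ↑ˡ n) ≡ lookup (take m v) j
lookup-↑ˡ {m = m} v j = begin
  lookup v (j ↑ˡ _)                      ≡⟨ cong (λ u → lookup u (j ↑ˡ _)) (take++drop≡id m v) ⟨
  lookup (take m v ++ drop m v) (j ↑ˡ _) ≡⟨ lookup-++ˡ (take m v) (drop m v) j ⟩
  lookup (take m v) j                    ∎
  where open ≡-Reasoning

lookup-↑ʳ : (v : Vec A (m + n)) (j : Fin n) → lookup v (m ↑ʳ j) ≡ lookup (drop m v) j
lookup-↑ʳ {m = m} v j = begin
  lookup v (m ↑ʳ j)                      ≡⟨ cong (λ u → lookup u (m ↑ʳ j)) (take++drop≡id m v) ⟨
  lookup (take m v ++ drop m v) (m ↑ʳ j) ≡⟨ lookup-++ʳ (take m v) (drop m v) j ⟩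
  lookup (drop m v) j                    ∎
  where open ≡-Reasoning

NEQ⇔ : {v : Vec Bool (n + n)} → NEQ n v ≡ true ⇔ take n v ≢ drop n v
NEQ⇔ {n} {v} = not-does⇔ (≡-dec Bool._≟_ (take n v) (drop n v))

NEQ-++⇔ : {x y : Vec Bool n} → NEQ n (x ++ y) ≡ true ⇔ x ≢ y
NEQ-++⇔ {n} {x} {y} =
  subst₂ (λ u w → NEQ n (x ++ y) ≡ true ⇔ u ≢ w) (proj₁ (++-split x y)) (proj₂ (++-split x y)) NEQ⇔

EQ-++⇔ : {x y : Vec Bool n} → EQ n (x ++ y) ≡ true ⇔ x ≡ y
EQ-++⇔ {x = x} {y} = mk⇔
  (λ eq → decidable-stable (≡-dec Bool._≟_ x y) (λ x≢y → to not≡true⇔ eq (from NEQ-++⇔ x≢y)))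
  (λ x≡y → from not≡true⇔ (λ neq → to NEQ-++⇔ neq x≡y))

NEQ⇔∃lookup≢ : {v : Vec Bool (n + n)} → NEQ n v ≡ true ⇔ ∃ λ j → lookup v (j ↑ˡ n) ≢ lookup v (n ↑ʳ j)
NEQ⇔∃lookup≢ {n} {v} = mk⇔
  (λ neq → let j , ≢ = ≢⇒∃lookup≢ Bool._≟_ (to NEQ⇔ neq) in
           j , λ eq → ≢ (trans (sym (lookup-↑ˡ v j)) (trans eq (lookup-↑ʳ v j))))
  (λ (j , ≢) → from NEQ⇔ λ take≡drop →
           ≢ (trans (lookup-↑ˡ v j) (trans (cong (λ u → lookup u j) take≡drop) (sym (lookup-↑ʳ v j)))))

EQ⇒lookup≡ : {v : Vec Bool (n + n)} → EQ n v ≡ true → ∀ j → lookup v (j ↑ˡ n) ≡ lookup v (n ↑ʳ j)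
EQ⇒lookup≡ eq j = decidable-stable (_ Bool.≟ _) (λ ≢ → to not≡true⇔ eq (from NEQ⇔∃lookup≢ (j , ≢)))

data Mix : Vec Bool m → Vec Bool m → Vec Bool m → Set where
  []    : Mix [] [] []
  left  : {v w u : Vec Bool m} → Mix v w u → Mix (a ∷ v) (b ∷ w) (a ∷ u)
  right : {v w u : Vec Bool m} → Mix v w u → Mix (a ∷ v) (b ∷ w) (b ∷ u)

mix-left : (v w : Vec Bool m) → Mix v w v
mix-left []      []      = []
mix-left (_ ∷ v) (_ ∷ w) = left (mix-left v w)

mix-right : (v w : Vec Bool m) → Mix v w w
mix-right []      []      = []
mix-right (_ ∷ v) (_ ∷ w) = right (mix-right v w)

mix-++ : {v w u : Vec Bool m} {v′ w′ u′ : Vec Bool n} →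
         Mix v w u → Mix v′ w′ u′ → Mix (v ++ v′) (w ++ w′) (u ++ u′)
mix-++ []          mix′ = mix′
mix-++ (left  mix) mix′ = left  (mix-++ mix mix′)
mix-++ (right mix) mix′ = right (mix-++ mix mix′)

mix-lookup : {v w u : Vec Bool m} → Mix v w u → ∀ i → lookup u i ≡ lookup v i ⊎ lookup u i ≡ lookup w i
mix-lookup (left  mix) Fin.zero    = inj₁ refl
mix-lookup (right mix) Fin.zero    = inj₂ refl
mix-lookup (left  mix) (Fin.suc i) = mix-lookup mix i
mix-lookup (right mix) (Fin.suc i) = mix-lookup mix i

mix-diagonals : (x y : Vec Bool n) → Mix (x ++ x) (y ++ y) (x ++ y)
mix-diagonals x y = mix-++ (mix-left x y) (mix-right x y)

-- Circuits

dualOp : Op → Op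
dualOp AND = OR
dualOp OR  = AND

dualWire : Wire m g → Wire m g
dualWire (lit i b) = lit i (not b)
dualWire (gate j)  = gate j

dualGates : Gates m g → Gates m g
dualGates []                   = []
dualGates (gs ▷ (o , w₁ , w₂)) = dualGates gs ▷ (dualOp o , dualWire w₁ , dualWire w₂)

dual : Circuit m → Circuit m
dual (circuit _ gs out) = circuit _ (dualGates gs) (dualWire out)

applyOp-dual : ∀ o a b → applyOp (dualOp o) (not a) (not b) ≡ not (applyOp o a b)
applyOp-dual AND true  _ = refl
applyOp-dual AND false _ = refl
applyOp-dual OR  true  _ = refl
applyOp-dual OR  false _ = refl

evalWire-dual : (w : Wire m g) (x : Vec Bool m) (vs : Vec Bool g) →
                evalWire (dualWire w) x (map not vs) ≡ not (evalWire w x vs)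
evalWire-dual (lit i true)  x vs = refl
evalWire-dual (lit i false) x vs = sym (Bool.not-involutive _)
evalWire-dual (gate j)      x vs = lookup-map j not vs

evalGates-dual : (gs : Gates m g) (x : Vec Bool m) → evalGates (dualGates gs) x ≡ map not (evalGates gs x)
evalGates-dual []                   x = refl
evalGates-dual (gs ▷ (o , w₁ , w₂)) x
  rewrite evalGates-dual gs x
        | evalWire-dual w₁ x (evalGates gs x) | evalWire-dual w₂ x (evalGates gs x)
        | applyOp-dual o (evalWire w₁ x (evalGates gs x)) (evalWire w₂ x (evalGates gs x))
  = sym (map-∷ʳ not _ (evalGates gs x))

eval-dual : (C : Circuit m) (x : Vec Bool m) → eval (dual C) x ≡ not (eval C x)
eval-dual (circuit _ gs out) x rewrite evalGates-dual gs x = evalWire-dual out x (evalGates gs x)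

dual≡true⇔ : (C : Circuit m) (x : Vec Bool m) → eval (dual C) x ≡ true ⇔ eval C x ≢ true
dual≡true⇔ C x = subst (λ b → b ≡ true ⇔ eval C x ≢ true) (sym (eval-dual C x)) not≡true⇔

countOpG-dual : ∀ o (gs : Gates m g) → countOpG o (dualGates gs) ≡ countOpG (dualOp o) gs
countOpG-dual o   []               = refl
countOpG-dual AND (gs ▷ (AND , _)) = countOpG-dual AND gs
countOpG-dual AND (gs ▷ (OR  , _)) = cong suc (countOpG-dual AND gs)
countOpG-dual OR  (gs ▷ (AND , _)) = cong suc (countOpG-dual OR gs)
countOpG-dual OR  (gs ▷ (OR  , _)) = countOpG-dual OR gs

#OR-dual : (C : Circuit m) → #OR (dual C) ≡ #AND C
#OR-dual C = countOpG-dual OR (Circuit.gates C)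

#AND-dual : (C : Circuit m) → #AND (dual C) ≡ #OR C
#AND-dual C = countOpG-dual AND (Circuit.gates C)

module _ {m m′ : ℕ} (ρ : Fin m → Fin m′) where

  renameWire : Wire m g → Wire m′ g
  renameWire (lit i b) = lit (ρ i) b
  renameWire (gate j)  = gate j

  renameGates : Gates m g → Gates m′ g
  renameGates []                   = []
  renameGates (gs ▷ (o , w₁ , w₂)) = renameGates gs ▷ (o , renameWire w₁ , renameWire w₂)

  rename : Circuit m → Circuit m′
  rename (circuit _ gs out) = circuit _ (renameGates gs) (renameWire out)

  module _ {x : Vec Bool m} {x′ : Vec Bool m′} (x′∘ρ≗x : ∀ i → lookup x′ (ρ i) ≡ lookup x i) where

    evalWire-rename : (w : Wire m g) (vs : Vec Bool g) → evalWire (renameWire w) x′ vs ≡ evalWire w x vs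
    evalWire-rename (lit i b) vs = cong (λ xᵢ → if b then xᵢ else not xᵢ) (x′∘ρ≗x i)
    evalWire-rename (gate j)  vs = refl

    evalGates-rename : (gs : Gates m g) → evalGates (renameGates gs) x′ ≡ evalGates gs x
    evalGates-rename []                   = refl
    evalGates-rename (gs ▷ (o , w₁ , w₂))
      rewrite evalGates-rename gs
            | evalWire-rename w₁ (evalGates gs x) | evalWire-rename w₂ (evalGates gs x) = refl

    eval-rename : (C : Circuit m) → eval (rename C) x′ ≡ eval C x
    eval-rename (circuit _ gs out) rewrite evalGates-rename gs = evalWire-rename out (evalGates gs x)

  countOpG-rename : ∀ o (gs : Gates m g) → countOpG o (renameGates gs) ≡ countOpG o gs
  countOpG-rename o   []               = refl
  countOpG-rename AND (gs ▷ (AND , _)) = cong suc (countOpG-rename AND gs)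
  countOpG-rename AND (gs ▷ (OR  , _)) = countOpG-rename AND gs
  countOpG-rename OR  (gs ▷ (AND , _)) = countOpG-rename OR gs
  countOpG-rename OR  (gs ▷ (OR  , _)) = cong suc (countOpG-rename OR gs)

orChoices : (gs : Gates m g) → Vec Bool m → Vec Bool (countOpG OR gs)
orChoices []                   x = []
orChoices (gs ▷ (AND , _))     x = orChoices gs x
orChoices (gs ▷ (OR , w₁ , _)) x = evalWire w₁ x (evalGates gs x) ∷ orChoices gs x

data ConjBelow : Vec Bool g → Vec Bool g → Vec Bool g → Set where
  []  : ConjBelow [] [] []
  _∷_ : {vs ws us : Vec Bool g} →
        (a ≡ true → b ≡ true → c ≡ true) → ConjBelow vs ws us → ConjBelow (a ∷ vs) (b ∷ ws) (c ∷ us)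

conjBelow-∷ʳ : {vs ws us : Vec Bool g} → ConjBelow vs ws us →
               (a ≡ true → b ≡ true → c ≡ true) → ConjBelow (vs ∷ʳ a) (ws ∷ʳ b) (us ∷ʳ c)
conjBelow-∷ʳ []           h = h ∷ []
conjBelow-∷ʳ (h′ ∷ below) h = h′ ∷ conjBelow-∷ʳ below h

conjBelow-lookup : {vs ws us : Vec Bool g} → ConjBelow vs ws us →
                   ∀ j → lookup vs j ≡ true → lookup ws j ≡ true → lookup us j ≡ true
conjBelow-lookup (h ∷ _)     Fin.zero    = h
conjBelow-lookup (_ ∷ below) (Fin.suc j) = conjBelow-lookup below j

literal-mix : ∀ b {p q r} → r ≡ p ⊎ r ≡ q →
              (if b then p else not p) ≡ true → (if b then q else not q) ≡ true →
              (if b then r else not r) ≡ true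
literal-mix b (inj₁ refl) hp _  = hp
literal-mix b (inj₂ refl) _  hq = hq

∧-mix : ∀ {a a′ a″ b b′ b″} → (a ≡ true → a′ ≡ true → a″ ≡ true) → (b ≡ true → b′ ≡ true → b″ ≡ true) →
        a ∧ b ≡ true → a′ ∧ b′ ≡ true → a″ ∧ b″ ≡ true
∧-mix {true} {true} {b = true} {true} ha hb _ _ rewrite ha refl refl | hb refl refl = refl

-- Fails without a ≡ a′: take a = b′ = true and a′ = b = a″ = b″ = false.
∨-mix : ∀ {a a′ a″ b b′ b″} → a ≡ a′ →
        (a ≡ true → a′ ≡ true → a″ ≡ true) → (b ≡ true → b′ ≡ true → b″ ≡ true) →
        a ∨ b ≡ true → a′ ∨ b′ ≡ true → a″ ∨ b″ ≡ true
∨-mix {true}  refl ha _  _  _  rewrite ha refl refl = refl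
∨-mix {false} refl _  hb h  h′ rewrite hb h h′      = Bool.∨-zeroʳ _

module _ {v w u : Vec Bool m} (mix : Mix v w u) where

  evalWire-mix : {vs ws us : Vec Bool g} → ConjBelow vs ws us → (r : Wire m g) →
                 evalWire r v vs ≡ true → evalWire r w ws ≡ true → evalWire r u us ≡ true
  evalWire-mix below (lit i b) = literal-mix b (mix-lookup mix i)
  evalWire-mix below (gate j)  = conjBelow-lookup below j

  evalGates-mix : (gs : Gates m g) → orChoices gs v ≡ orChoices gs w →
                  ConjBelow (evalGates gs v) (evalGates gs w) (evalGates gs u)
  evalGates-mix []                     _    = []
  evalGates-mix (gs ▷ (AND , w₁ , w₂)) same =
    let below = evalGates-mix gs same in
    conjBelow-∷ʳ below (∧-mix (evalWire-mix below w₁) (evalWire-mix below w₂))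
  evalGates-mix (gs ▷ (OR , w₁ , w₂))  same =
    let below = evalGates-mix gs (∷-injectiveʳ same) in
    conjBelow-∷ʳ below (∨-mix (∷-injectiveˡ same) (evalWire-mix below w₁) (evalWire-mix below w₂))

  eval-mix : (C : Circuit m) → orChoices (Circuit.gates C) v ≡ orChoices (Circuit.gates C) w →
             eval C v ≡ true → eval C w ≡ true → eval C u ≡ true
  eval-mix (circuit _ gs out) same = evalWire-mix (evalGates-mix gs same) out

sizeAND⇒sizeOR-not : {f : Vec Bool m → Bool} → SizeAND f s → SizeOR (not ∘ f) s
sizeAND⇒sizeOR-not (C , computes , refl) =
  dual C , (λ x → trans (eval-dual C x) (cong not (computes x))) , #OR-dual C

sizeOR⇒nondetSizeOR : {f : Vec Bool m → Bool} → SizeOR f s → NondetSizeOR f s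
sizeOR⇒nondetSizeOR {m} {f = f} (C@(circuit _ gs _) , computes , refl) =
  0 , C′ , (λ x → (λ fx → [] , trans (eval-C′ x []) fx) , λ (y , acc) → trans (sym (eval-C′ x y)) acc) ,
  countOpG-rename (_↑ˡ 0) OR gs
  where
  C′ : Circuit (m + 0)
  C′ = rename (_↑ˡ 0) C
  eval-C′ : ∀ x y → eval C′ (x ++ y) ≡ f x
  eval-C′ x y = trans (eval-rename (_↑ˡ 0) (lookup-++ˡ x y) C) (computes x)

nondetSizeOR-not⇒conondetSizeAND : {f : Vec Bool m → Bool} → NondetSizeOR (not ∘ f) s → ConondetSizeAND f s
nondetSizeOR-not⇒conondetSizeAND {f = f} (k , C , correct , refl) =
  k , dual C , (λ x → sound x , complete x) , #AND-dual C
  where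
  sound : ∀ x → f x ≡ true → ∀ y → eval (dual C) (x ++ y) ≡ true
  sound x fx y = from (dual≡true⇔ C _) (λ acc → to not≡true⇔ (proj₂ (correct x) (y , acc)) fx)
  complete : ∀ x → (∀ y → eval (dual C) (x ++ y) ≡ true) → f x ≡ true
  complete x all-dual = decidable-stable (f x Bool.≟ true) λ fx≢true →
    let y , acc = proj₁ (correct x) (from not≡true⇔ fx≢true) in to (dual≡true⇔ C _) (all-dual y) acc

conondetSizeAND⇒nondetSizeOR-not : {f : Vec Bool m → Bool} → ConondetSizeAND f s → NondetSizeOR (not ∘ f) s
conondetSizeAND⇒nondetSizeOR-not {f = f} (k , D , correct , refl) =
  k , dual D , (λ x → complete x , sound x) , #OR-dual D
  where
  complete : ∀ x → not (f x) ≡ true → Σ[ y ∈ Vec Bool k ] eval (dual D) (x ++ y) ≡ true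
  complete x nfx =
    let y , rejects = cube-¬∀⇒∃¬ _ (λ y → eval D (x ++ y) Bool.≟ true)
                        (λ all → to not≡true⇔ nfx (proj₂ (correct x) all))
    in y , from (dual≡true⇔ D _) rejects
  sound : ∀ x → Σ[ y ∈ Vec Bool k ] eval (dual D) (x ++ y) ≡ true → not (f x) ≡ true
  sound x (y , acc) = from not≡true⇔ (λ fx → to (dual≡true⇔ D _) acc (proj₁ (correct x) fx y))

nondetSizeOR-EQ⇒≤ : NondetSizeOR (EQ n) s → n ≤ s
nondetSizeOR-EQ⇒≤ {n} (k , C , correct , refl) = cube-injective⇒≤ choices choices-injective
  where
  witness : (x : Vec Bool n) → Σ[ y ∈ Vec Bool k ] eval C ((x ++ x) ++ y) ≡ true
  witness x = proj₁ (correct (x ++ x)) (from (EQ-++⇔ {x = x}) refl)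
  choices : Vec Bool n → Vec Bool (#OR C)
  choices x = orChoices (Circuit.gates C) ((x ++ x) ++ proj₁ (witness x))
  choices-injective : Injective _≡_ _≡_ choices
  choices-injective {x} {x′} same = to (EQ-++⇔ {x = x}) (proj₂ (correct (x ++ x′)) (proj₁ (witness x) ,
    eval-mix (mix-++ (mix-diagonals x x′) (mix-left _ _)) C same (proj₂ (witness x)) (proj₂ (witness x′))))

-- Formulas as circuits

data Formula (m : ℕ) : Set where
  literal : Fin m → Bool → Formula m
  node    : Op → Formula m → Formula m → Formula m

⟦_⟧ : Formula m → Vec Bool m → Bool
⟦ literal i b ⟧ x = if b then lookup x i else not (lookup x i)
⟦ node o φ ψ  ⟧ x = applyOp o (⟦ φ ⟧ x) (⟦ ψ ⟧ x)

countOp : Op → Op → ℕ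
countOp AND AND = 1
countOp AND OR  = 0
countOp OR  AND = 0
countOp OR  OR  = 1

countF : Op → Formula m → ℕ
countF o (literal _ _) = 0
countF o (node o′ φ ψ) = countOp o o′ + (countF o φ + countF o ψ)

countOpG-▷ : ∀ o o′ (gs : Gates m g) t → countOpG o (gs ▷ (o′ , t)) ≡ countOp o o′ + countOpG o gs
countOpG-▷ AND AND gs t = refl
countOpG-▷ AND OR  gs t = refl
countOpG-▷ OR  AND gs t = refl
countOpG-▷ OR  OR  gs t = refl

data _≼_ {m : ℕ} : {g g′ : ℕ} → Gates m g → Gates m g′ → Set where
  ≼-refl : {gs : Gates m g} → gs ≼ gs
  ≼-step : ∀ {g′} {gs : Gates m g} {gs′ : Gates m g′} {t} → gs ≼ gs′ → gs ≼ (gs′ ▷ t)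

≼-trans : ∀ {g₁ g₂ g₃} {gs₁ : Gates m g₁} {gs₂ : Gates m g₂} {gs₃ : Gates m g₃} →
          gs₁ ≼ gs₂ → gs₂ ≼ gs₃ → gs₁ ≼ gs₃
≼-trans p ≼-refl     = p
≼-trans p (≼-step q) = ≼-step (≼-trans p q)

lookup-∷ʳ-inject₁ : (vs : Vec A g) (a : A) (j : Fin g) → lookup (vs ∷ʳ a) (inject₁ j) ≡ lookup vs j
lookup-∷ʳ-inject₁ (v ∷ vs) a Fin.zero    = refl
lookup-∷ʳ-inject₁ (v ∷ vs) a (Fin.suc j) = lookup-∷ʳ-inject₁ vs a j

lookup-∷ʳ-last : (vs : Vec A g) (a : A) → lookup (vs ∷ʳ a) (fromℕ g) ≡ a
lookup-∷ʳ-last []       a = refl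
lookup-∷ʳ-last (v ∷ vs) a = lookup-∷ʳ-last vs a

weakenWire₁ : Wire m g → Wire m (suc g)
weakenWire₁ (lit i b) = lit i b
weakenWire₁ (gate j)  = gate (inject₁ j)

evalWire-weaken₁ : (w : Wire m g) (x : Vec Bool m) (vs : Vec Bool g) (a : Bool) →
                   evalWire (weakenWire₁ w) x (vs ∷ʳ a) ≡ evalWire w x vs
evalWire-weaken₁ (lit i b) x vs a = refl
evalWire-weaken₁ (gate j)  x vs a = lookup-∷ʳ-inject₁ vs a j

weakenWire : ∀ {g′} {gs : Gates m g} {gs′ : Gates m g′} → gs ≼ gs′ → Wire m g → Wire m g′
weakenWire ≼-refl     w = w
weakenWire (≼-step p) w = weakenWire₁ (weakenWire p w)

evalWire-weaken : ∀ {g′} {gs : Gates m g} {gs′ : Gates m g′} (p : gs ≼ gs′) (w : Wire m g) (x : Vec Bool m) →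
                  evalWire (weakenWire p w) x (evalGates gs′ x) ≡ evalWire w x (evalGates gs x)
evalWire-weaken ≼-refl w x = refl
evalWire-weaken {gs′ = gs′ ▷ _} (≼-step p) w x =
  trans (evalWire-weaken₁ (weakenWire p w) x (evalGates gs′ x) _) (evalWire-weaken p w x)

record Extension {m g : ℕ} (gs : Gates m g) : Set where
  constructor extension
  field
    {size}   : ℕ
    extended : Gates m size
    prefix   : gs ≼ extended
    output   : Wire m size
open Extension

compile : (gs : Gates m g) → Formula m → Extension gs
compile gs (literal i b) = extension gs ≼-refl (lit i b)
compile gs (node o φ ψ)  =
  extension (extended r₂ ▷ (o , weakenWire (prefix r₂) (output r₁) , output r₂))
            (≼-step (≼-trans (prefix r₁) (prefix r₂))) (gate (fromℕ _))
  where
  r₁ : Extension gs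
  r₁ = compile gs φ
  r₂ : Extension (extended r₁)
  r₂ = compile (extended r₁) ψ

eval-compile : (gs : Gates m g) (φ : Formula m) (x : Vec Bool m) →
               evalWire (output (compile gs φ)) x (evalGates (extended (compile gs φ)) x) ≡ ⟦ φ ⟧ x
eval-compile gs (literal i b) x = refl
eval-compile gs (node o φ ψ)  x =
  trans (lookup-∷ʳ-last (evalGates (extended r₂) x) _)
        (cong₂ (applyOp o) (trans (evalWire-weaken (prefix r₂) (output r₁) x) (eval-compile gs φ x))
                           (eval-compile (extended r₁) ψ x))
  where
  r₁ : Extension gs
  r₁ = compile gs φ
  r₂ : Extension (extended r₁)
  r₂ = compile (extended r₁) ψ

+-interchange : ∀ a b c d → a + ((b + c) + d) ≡ b + (a + (c + d))
+-interchange = solve-∀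

countOpG-compile : ∀ o (gs : Gates m g) (φ : Formula m) →
                   countOpG o (extended (compile gs φ)) ≡ countOpG o gs + countF o φ
countOpG-compile o gs (literal i b) = sym (+-identityʳ _)
countOpG-compile o gs (node o′ φ ψ) = begin
  countOpG o (extended r₂ ▷ _)
    ≡⟨ countOpG-▷ o o′ (extended r₂) _ ⟩
  countOp o o′ + countOpG o (extended r₂)
    ≡⟨ cong (countOp o o′ +_) (countOpG-compile o (extended r₁) ψ) ⟩
  countOp o o′ + (countOpG o (extended r₁) + countF o ψ)
    ≡⟨ cong (λ c → countOp o o′ + (c + countF o ψ)) (countOpG-compile o gs φ) ⟩
  countOp o o′ + ((countOpG o gs + countF o φ) + countF o ψ)
    ≡⟨ +-interchange (countOp o o′) (countOpG o gs) (countF o φ) (countF o ψ) ⟩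
  countOpG o gs + (countOp o o′ + (countF o φ + countF o ψ))
    ∎
  where
  open ≡-Reasoning
  r₁ : Extension gs
  r₁ = compile gs φ
  r₂ : Extension (extended r₁)
  r₂ = compile (extended r₁) ψ

toCircuit : Formula m → Circuit m
toCircuit φ = circuit _ (extended (compile [] φ)) (output (compile [] φ))

toCircuit-computes : (φ : Formula m) → Computes (toCircuit φ) ⟦ φ ⟧
toCircuit-computes φ = eval-compile [] φ

#AND-toCircuit : (φ : Formula m) → #AND (toCircuit φ) ≡ countF AND φ
#AND-toCircuit φ = countOpG-compile AND [] φ

⋁ : (Fin (suc k) → Formula m) → Formula m
⋁ {zero}  φ = φ Fin.zero
⋁ {suc k} φ = node OR (φ Fin.zero) (⋁ (φ ∘ Fin.suc))

⋁≡true⇔ : (φ : Fin (suc k) → Formula m) (x : Vec Bool m) → ⟦ ⋁ φ ⟧ x ≡ true ⇔ ∃ λ i → ⟦ φ i ⟧ x ≡ true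
⋁≡true⇔ {zero}  φ x = mk⇔ (Fin.zero ,_) (λ { (Fin.zero , h) → h ; (Fin.suc () , _) })
⋁≡true⇔ {suc k} φ x = mk⇔
  (λ h → [ (Fin.zero ,_) , (Product.map Fin.suc (λ hᵢ → hᵢ) ∘ to (⋁≡true⇔ (φ ∘ Fin.suc) x)) ]′ (to ∨≡true⇔ h))
  (λ { (Fin.zero , h)  → from ∨≡true⇔ (inj₁ h)
     ; (Fin.suc i , h) → from (∨≡true⇔ {⟦ φ Fin.zero ⟧ x}) (inj₂ (from (⋁≡true⇔ (φ ∘ Fin.suc) x) (i , h))) })

countF-⋁ : (φ : Fin (suc k) → Formula m) → (∀ i → countF AND (φ i) ≡ 1) → countF AND (⋁ φ) ≡ suc k
countF-⋁ {zero}  φ one = one Fin.zero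
countF-⋁ {suc k} φ one rewrite one Fin.zero | countF-⋁ (φ ∘ Fin.suc) (one ∘ Fin.suc) = refl

xor : Fin m → Fin m → Formula m
xor i j = node AND (node OR (literal i true)  (literal j true))
                   (node OR (literal i false) (literal j false))

xor≡true⇔ : (i j : Fin m) (x : Vec Bool m) → ⟦ xor i j ⟧ x ≡ true ⇔ lookup x i ≢ lookup x j
xor≡true⇔ i j x with lookup x i | lookup x j
... | true  | true  = mk⇔ (λ ()) (λ ≢ → contradiction refl ≢)
... | true  | false = mk⇔ (λ _ ()) (λ _ → refl)
... | false | true  = mk⇔ (λ _ ()) (λ _ → refl)
... | false | false = mk⇔ (λ ()) (λ ≢ → contradiction refl ≢)

halvesDiffer : ∀ k → Fin (suc k) → Formula (suc k + suc k)
halvesDiffer k j = xor (j ↑ˡ suc k) (suc k ↑ʳ j)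

⟦⋁halvesDiffer⟧ : ∀ k → ⟦ ⋁ (halvesDiffer k) ⟧ ≗ NEQ (suc k)
⟦⋁halvesDiffer⟧ k v = ≡true-ext (mk⇔
  (λ h → let j , hⱼ = to (⋁≡true⇔ (halvesDiffer k) v) h in
         from (NEQ⇔∃lookup≢ {v = v}) (j , to (xor≡true⇔ _ _ v) hⱼ))
  (λ h → let j , ≢ = to (NEQ⇔∃lookup≢ {v = v}) h in
         from (⋁≡true⇔ (halvesDiffer k) v) (j , from (xor≡true⇔ _ _ v) ≢)))

sizeAND-NEQ : ∀ k → SizeAND (NEQ (suc k)) (suc k)
sizeAND-NEQ k =
  toCircuit φ , (λ v → trans (toCircuit-computes φ v) (⟦⋁halvesDiffer⟧ k v)) ,
  trans (#AND-toCircuit φ) (countF-⋁ (halvesDiffer k) (λ _ → refl))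
  where
  φ : Formula (suc k + suc k)
  φ = ⋁ (halvesDiffer k)

-- Semi-filters and covering pairs

module _ {Γ : Set} where

  ∩-⊆ˡ : {S T : Subset Γ} → (S ∩ T) ⊆ S
  ∩-⊆ˡ _ = proj₁ ∘ to ∧≡true⇔

  ∩-⊆ʳ : {S T : Subset Γ} → (S ∩ T) ⊆ T
  ∩-⊆ʳ _ = proj₂ ∘ to ∧≡true⇔

  ∖-⊆ : {S T : Subset Γ} → (S ∖ T) ⊆ S
  ∖-⊆ _ = proj₁ ∘ to ∧≡true⇔

  singleton-⊆⇔ : {S W : Subset Γ} {p : Γ} → (∀ z → S z ≡ true ⇔ z ≡ p) → S ⊆ W ⇔ W p ≡ true
  singleton-⊆⇔ {W = W} S≐｛p｝ =
    mk⇔ (λ S⊆W → S⊆W _ (from (S≐｛p｝ _) refl))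
        (λ Wp z Sz → subst (λ z → W z ≡ true) (sym (to (S≐｛p｝ z) Sz)) Wp)

  _≐ᶠ_ : Family {Γ} → Family {Γ} → Set
  F ≐ᶠ F′ = ∀ W → F W ⇔ F′ W

  covers-≐ : {F F′ : Family} {E H : Subset Γ} → F ≐ᶠ F′ → Covers (E , H) F → Covers (E , H) F′
  covers-≐ {E = E} {H} F≐F′ (FE , FH , ¬F[E∩H]) =
    to (F≐F′ E) FE , to (F≐F′ H) FH , ¬F[E∩H] ∘ from (F≐F′ (E ∩ H))

module _ {Γ : Set} {U : Subset Γ} where

  semiFilter-≐ : {F F′ : Family} → F ≐ᶠ F′ → SemiFilter U F → SemiFilter U F′
  semiFilter-≐ F≐F′ sf = record
    { extensional = λ W V W≐V F′W → to (F≐F′ V) (extensional W V W≐V (from (F≐F′ W) F′W))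
    ; inside      = λ W F′W → inside W (from (F≐F′ W) F′W)
    ; nonempty    = proj₁ nonempty , to (F≐F′ _) (proj₂ nonempty)
    ; no-empty    = λ F′∅ → no-empty (from (F≐F′ ∅) F′∅)
    ; upward      = λ W V F′W W⊆V V⊆U → to (F≐F′ V) (upward W V (from (F≐F′ W) F′W) W⊆V V⊆U)
    }
    where open SemiFilter sf

  PairFilter : Γ → Γ → Family
  PairFilter p q W = W ⊆ U × (W p ≡ true ⊎ W q ≡ true)

  pairFilter-semiUltra : {p q : Γ} → U p ≡ true → SemiUltraFilter U (PairFilter p q)
  pairFilter-semiUltra {p} {q} Up = record
    { semiFilter = record
      { extensional = λ W V W≐V (W⊆U , Wp∨Wq) →
          (λ x Vx → W⊆U x (trans (W≐V x) Vx)) , Sum.map (trans (sym (W≐V p))) (trans (sym (W≐V q))) Wp∨Wq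
      ; inside      = λ W → proj₁
      ; nonempty    = U , (λ _ Ux → Ux) , inj₁ Up
      ; no-empty    = λ { (_ , inj₁ ()) ; (_ , inj₂ ()) }
      ; upward      = λ W V (_ , Wp∨Wq) W⊆V V⊆U → V⊆U , Sum.map (W⊆V p) (W⊆V q) Wp∨Wq
      }
    ; ultra = ultra
    }
    where
    ultra : ∀ W → W ⊆ U → PairFilter p q W ⊎ PairFilter p q (U ∖ W)
    ultra W W⊆U with W p
    ... | true  = inj₁ (W⊆U , inj₁ refl)
    ... | false = inj₂ (∖-⊆ {S = U} {T = W} , inj₁ (from ∧≡true⇔ (Up , refl)))

  pairFilter-covers⇒≢ : {p q : Γ} {E H : Subset Γ} → Covers (E , H) (PairFilter p q) → E p ≢ E q
  pairFilter-covers⇒≢ {p} {q} {E} {H} ((E⊆U , Ep∨Eq) , (_ , Hp∨Hq) , ¬F[E∩H]) Ep≡Eq =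
    ¬F[E∩H] ((λ x → E⊆U x ∘ ∩-⊆ˡ {S = E} {T = H} x) ,
             Sum.map (λ Hp → from ∧≡true⇔ (Ep , Hp)) (λ Hq → from ∧≡true⇔ (Eq , Hq)) Hp∨Hq)
    where
    Ep : E p ≡ true
    Ep = [ (λ Ep → Ep) , trans Ep≡Eq ]′ Ep∨Eq
    Eq : E q ≡ true
    Eq = trans (sym Ep≡Eq) Ep

  covering-pairFilters⇒≤ : (pt : Vec Bool n → Γ) (ps : Fin t → Subset Γ × Subset Γ) →
                           (∀ {x y} → x ≢ y → ∃ λ j → Covers (ps j) (PairFilter (pt x) (pt y))) → n ≤ t
  covering-pairFilters⇒≤ {n = n} {t = t} pt ps covered = cube-injective⇒≤ signature λ {x} {y} same →
    decidable-stable (≡-dec Bool._≟_ x y) λ x≢y →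
      let j , cov = covered x≢y in
      pairFilter-covers⇒≢ cov (begin
        proj₁ (ps j) (pt x)    ≡⟨ lookup∘tabulate _ j ⟨
        lookup (signature x) j ≡⟨ cong (λ σ → lookup σ j) same ⟩
        lookup (signature y) j ≡⟨ lookup∘tabulate _ j ⟩
        proj₁ (ps j) (pt y)    ∎)
    where
    open ≡-Reasoning
    signature : Vec Bool n → Vec Bool t
    signature x = tabulate (λ j → proj₁ (ps j) (pt x))

  splitBy : Subset Γ → Subset Γ × Subset Γ
  splitBy S = U ∩ S , U ∖ S

  splitBy-⊆ : (S : Fin t → Subset Γ) → PairsIn U (λ j → splitBy (S j))
  splitBy-⊆ S j = ∩-⊆ˡ {S = U} {T = S j} , ∖-⊆ {S = U} {T = S j}

  splitBy-disjoint : (S : Subset Γ) → ((U ∩ S) ∩ (U ∖ S)) ≐ ∅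
  splitBy-disjoint S x with U x | S x
  ... | true  | true  = refl
  ... | true  | false = refl
  ... | false | _     = refl

  disjoint-covers : {F : Family} {P Q E H : Subset Γ} → SemiFilter U F → F P → F Q →
                    P ⊆ E → Q ⊆ H → E ⊆ U → H ⊆ U → (E ∩ H) ≐ ∅ → Covers (E , H) F
  disjoint-covers sf FP FQ P⊆E Q⊆H E⊆U H⊆U E∩H≐∅ =
    upward _ _ FP P⊆E E⊆U , upward _ _ FQ Q⊆H H⊆U , λ F[E∩H] → no-empty (extensional _ ∅ E∩H≐∅ F[E∩H])
    where open SemiFilter sf

  splitBy-covers : {F : Family} {P Q S : Subset Γ} → SemiFilter U F → F P → F Q →
                   (∀ z → P z ≡ true → S z ≡ a) → (∀ z → Q z ≡ true → S z ≡ b) → a ≢ b →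
                   Covers (splitBy S) F
  splitBy-covers {true} {false} {P = P} {Q} {S} sf FP FQ P⇒S Q⇒¬S _ =
    disjoint-covers sf FP FQ
      (λ z Pz → from ∧≡true⇔ (inside P FP z Pz , P⇒S z Pz))
      (λ z Qz → from ∧≡true⇔ (inside Q FQ z Qz , cong not (Q⇒¬S z Qz)))
      (∩-⊆ˡ {S = U} {T = S}) (∖-⊆ {S = U} {T = S}) (splitBy-disjoint S)
    where open SemiFilter sf
  splitBy-covers {false} {true}  sf FP FQ P⇒a Q⇒b a≢b = splitBy-covers sf FQ FP Q⇒b P⇒a (a≢b ∘ sym)
  splitBy-covers {true}  {true}  _  _  _  _   _   a≢b = contradiction refl a≢b
  splitBy-covers {false} {false} _  _  _  _   _   a≢b = contradiction refl a≢b

-- The grid [N] × [N]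

-- Definitionally the ground set U = Ḡ of RhoCan N (G-NEQ N) and RhoUltra _ (G-NEQ N).
Diagonal : ∀ N → Subset (Grid N)
Diagonal N = (λ _ → true) ∖ G-NEQ N

module _ {N : ℕ} where

  G-NEQ⇔ : {x y : Fin N} → G-NEQ N (x , y) ≡ true ⇔ x ≢ y
  G-NEQ⇔ {x} {y} = not-does⇔ (x Fin.≟ y)

  Diagonal⇔ : {x y : Fin N} → Diagonal N (x , y) ≡ true ⇔ x ≡ y
  Diagonal⇔ {x} {y} = mk⇔
    (λ h → decidable-stable (x Fin.≟ y) (λ x≢y → to not≡true⇔ h (from G-NEQ⇔ x≢y)))
    (λ x≡y → from not≡true⇔ (λ h → to G-NEQ⇔ h x≡y))

  Row∩Diagonal⇔ : {a : Fin N} (z : Grid N) → (Row a ∩ Diagonal N) z ≡ true ⇔ z ≡ (a , a)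
  Row∩Diagonal⇔ {a} (x , y) = mk⇔
    (λ h → let row , diag = to ∧≡true⇔ h
               x≡a = to (does⇔ (x Fin.≟ a)) row
           in cong₂ _,_ x≡a (trans (sym (to Diagonal⇔ diag)) x≡a))
    (λ { refl → from ∧≡true⇔ (from (does⇔ (a Fin.≟ a)) refl , from (Diagonal⇔ {a}) refl) })

  Col∩Diagonal⇔ : {b : Fin N} (z : Grid N) → (Col b ∩ Diagonal N) z ≡ true ⇔ z ≡ (b , b)
  Col∩Diagonal⇔ {b} (x , y) = mk⇔
    (λ h → let col , diag = to ∧≡true⇔ h
               y≡b = to (does⇔ (y Fin.≟ b)) col
           in cong₂ _,_ (trans (to Diagonal⇔ diag) y≡b) y≡b)
    (λ { refl → from ∧≡true⇔ (from (does⇔ (b Fin.≟ b)) refl , from (Diagonal⇔ {b}) refl) })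

  Fcan≐PairFilter : (a b : Fin N) → Fcan (G-NEQ N) (a , b) ≐ᶠ PairFilter {U = Diagonal N} (a , a) (b , b)
  Fcan≐PairFilter a b W = mk⇔
    (Product.map₂ (Sum.map (to (singleton-⊆⇔ Row∩Diagonal⇔)) (to (singleton-⊆⇔ Col∩Diagonal⇔))))
    (Product.map₂ (Sum.map (from (singleton-⊆⇔ Row∩Diagonal⇔)) (from (singleton-⊆⇔ Col∩Diagonal⇔))))

module _ {n : ℕ} where

  code : Vec Bool n → Fin (2 ^ n)
  code = Inverse.to (Vec↔Fin[2^n] n)

  bits : Fin (2 ^ n) → Vec Bool n
  bits = Inverse.from (Vec↔Fin[2^n] n)

  code-≢ : {x y : Vec Bool n} → x ≢ y → code x ≢ code y
  code-≢ x≢y = x≢y ∘ Injection.injective (↔⇒↣ (Vec↔Fin[2^n] n))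

  bits-≢ : {a b : Fin (2 ^ n)} → a ≢ b → bits a ≢ bits b
  bits-≢ a≢b = a≢b ∘ Injection.injective (↔⇒↣ (↔-sym (Vec↔Fin[2^n] n)))

  diagonalPairFilter-above : (x y : Vec Bool n) →
    Above (GenGrid (2 ^ n)) (Diagonal (2 ^ n))
          (PairFilter {U = Diagonal (2 ^ n)} (code x , code x) (code y , code y)) (code x , code y)
  diagonalPairFilter-above x y (inj₁ r) h =
    ∩-⊆ʳ {S = Row r} , inj₁ (from (Row∩Diagonal⇔ _) (cong (λ c → c , c) (to (does⇔ (code x Fin.≟ r)) h)))
  diagonalPairFilter-above x y (inj₂ c) h =
    ∩-⊆ʳ {S = Col c} , inj₂ (from (Col∩Diagonal⇔ _) (cong (λ c → c , c) (to (does⇔ (code y Fin.≟ c)) h)))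

  rhoUltra-G-NEQ⇒≤ : RhoUltra (GenGrid (2 ^ n)) (G-NEQ (2 ^ n)) t → n ≤ t
  rhoUltra-G-NEQ⇒≤ (ps , _ , covered) = covering-pairFilters⇒≤ (λ x → code x , code x) ps λ {x} {y} x≢y →
    covered _ (pairFilter-semiUltra (from (Diagonal⇔ {x = code x}) refl))
            ((code x , code y) , from G-NEQ⇔ (code-≢ x≢y) , diagonalPairFilter-above x y)

  rhoCan-G-NEQ⇒≤ : RhoCan (2 ^ n) (G-NEQ (2 ^ n)) t → n ≤ t
  rhoCan-G-NEQ⇒≤ (ps , _ , covered) = covering-pairFilters⇒≤ (λ x → code x , code x) ps λ {x} {y} x≢y →
    let j , cov = covered (code x , code y) (from G-NEQ⇔ (code-≢ x≢y))
                    (semiFilter-≐ (λ W → ⇔-sym (Fcan≐PairFilter _ _ W))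
                      (SemiUltraFilter.semiFilter (pairFilter-semiUltra (from (Diagonal⇔ {x = code x}) refl))))
    in j , covers-≐ (Fcan≐PairFilter _ _) cov

  bitSplit : Fin n → Subset (Grid (2 ^ n)) × Subset (Grid (2 ^ n))
  bitSplit j = splitBy {U = Diagonal (2 ^ n)} (λ (x , _) → lookup (bits x) j)

  bitSplit-covers : {F : Family} {a b : Fin (2 ^ n)} → SemiFilter (Diagonal (2 ^ n)) F →
                    F (Row a ∩ Diagonal _) → F (Col b ∩ Diagonal _) → a ≢ b → ∃ λ j → Covers (bitSplit j) F
  bitSplit-covers sf Frow Fcol a≢b =
    let j , ≢ = ≢⇒∃lookup≢ Bool._≟_ (bits-≢ a≢b) in
    j , splitBy-covers sf Frow Fcol
          (λ z h → cong (λ (x , _) → lookup (bits x) j) (to (Row∩Diagonal⇔ z) h))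
          (λ z h → cong (λ (x , _) → lookup (bits x) j) (to (Col∩Diagonal⇔ z) h)) ≢

  rhoCan-G-NEQ : RhoCan (2 ^ n) (G-NEQ (2 ^ n)) n
  rhoCan-G-NEQ = bitSplit , splitBy-⊆ _ , λ (a , b) a≢b sf →
    bitSplit-covers sf (∩-⊆ʳ , inj₁ (λ _ h → h)) (∩-⊆ʳ , inj₂ (λ _ h → h)) (to G-NEQ⇔ a≢b)

  rhoUltra-G-NEQ : RhoUltra (GenGrid (2 ^ n)) (G-NEQ (2 ^ n)) n
  rhoUltra-G-NEQ = bitSplit , splitBy-⊆ _ , λ F suf ((a , b) , a≢b , above) →
    bitSplit-covers (SemiUltraFilter.semiFilter suf)
      (above (inj₁ a) (from (does⇔ (a Fin.≟ a)) refl)) (above (inj₂ b) (from (does⇔ (b Fin.≟ b)) refl))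
      (to G-NEQ⇔ a≢b)

-- The cube {0,1}^(n+n)

-- Definitionally the ground set U of RhoUltra _ (NEQ n), i.e. the inputs accepted by EQ n.
CubeDiagonal : ∀ n → Subset (Vec Bool (n + n))
CubeDiagonal n = (λ _ → true) ∖ NEQ n

GenCube⇔ : (i : Fin m) (v : Vec Bool m) → GenCube m (i , b) v ≡ true ⇔ lookup v i ≡ b
GenCube⇔ {b = b} i v = does⇔ (lookup v i Bool.≟ b)

module _ {n : ℕ} where

  cubeDiagonalPairFilter-above : (x y : Vec Bool n) →
    Above (GenCube (n + n)) (CubeDiagonal n) (PairFilter {U = CubeDiagonal n} (x ++ x) (y ++ y)) (x ++ y)
  cubeDiagonalPairFilter-above x y (i , c) h =
    ∩-⊆ʳ {S = GenCube _ (i , c)} , Sum.map (onDiagonal x) (onDiagonal y) (mix-lookup (mix-diagonals x y) i)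
    where
    onDiagonal : ∀ z → lookup (x ++ y) i ≡ lookup (z ++ z) i →
                 (GenCube _ (i , c) ∩ CubeDiagonal n) (z ++ z) ≡ true
    onDiagonal z eq = from ∧≡true⇔
      (from (GenCube⇔ i (z ++ z)) (trans (sym eq) (to (GenCube⇔ i (x ++ y)) h)) , from (EQ-++⇔ {x = z}) refl)

  rhoUltra-NEQ⇒≤ : RhoUltra (GenCube (n + n)) (NEQ n) t → n ≤ t
  rhoUltra-NEQ⇒≤ (ps , _ , covered) = covering-pairFilters⇒≤ (λ x → x ++ x) ps λ {x} {y} x≢y →
    covered _ (pairFilter-semiUltra (from (EQ-++⇔ {x = x}) refl))
            (x ++ y , from NEQ-++⇔ x≢y , cubeDiagonalPairFilter-above x y)

  halfSplit : Fin n → Subset (Vec Bool (n + n)) × Subset (Vec Bool (n + n))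
  halfSplit j = splitBy {U = CubeDiagonal n} (λ v → lookup v (j ↑ˡ n))

  halfSplit-covers : {F : Family} {w : Vec Bool (n + n)} {j : Fin n} → SemiFilter (CubeDiagonal n) F →
                     Above (GenCube (n + n)) (CubeDiagonal n) F w → lookup w (j ↑ˡ n) ≢ lookup w (n ↑ʳ j) →
                     Covers (halfSplit j) F
  halfSplit-covers {w = w} {j} sf above ≢ =
    splitBy-covers sf (above _ (from (GenCube⇔ (j ↑ˡ n) w) refl)) (above _ (from (GenCube⇔ (n ↑ʳ j) w) refl))
                   leftHalf rightHalf ≢
    where
    Bˡ Bʳ : Subset (Vec Bool (n + n))
    Bˡ = GenCube (n + n) (j ↑ˡ n , lookup w (j ↑ˡ n))
    Bʳ = GenCube (n + n) (n ↑ʳ j , lookup w (n ↑ʳ j))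
    leftHalf : ∀ z → (Bˡ ∩ CubeDiagonal n) z ≡ true → lookup z (j ↑ˡ n) ≡ lookup w (j ↑ˡ n)
    leftHalf z = to (GenCube⇔ (j ↑ˡ n) z) ∘ ∩-⊆ˡ {S = Bˡ} {T = CubeDiagonal n} z
    rightHalf : ∀ z → (Bʳ ∩ CubeDiagonal n) z ≡ true → lookup z (j ↑ˡ n) ≡ lookup w (n ↑ʳ j)
    rightHalf z h = trans (EQ⇒lookup≡ {v = z} (∩-⊆ʳ {S = Bʳ} {T = CubeDiagonal n} z h) j)
                          (to (GenCube⇔ (n ↑ʳ j) z) (∩-⊆ˡ {S = Bʳ} {T = CubeDiagonal n} z h))

  rhoUltra-NEQ : RhoUltra (GenCube (n + n)) (NEQ n) n
  rhoUltra-NEQ = halfSplit , splitBy-⊆ _ , λ F suf (w , neq , above) →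
    let j , ≢ = to (NEQ⇔∃lookup≢ {v = w}) neq in
    j , halfSplit-covers {w = w} (SemiUltraFilter.semiFilter suf) above ≢

corollary4p13 : (n : ℕ) → 1 ≤ n →
    Σ[ a₁ ∈ ℕ ] Σ[ a₂ ∈ ℕ ] Σ[ a₃ ∈ ℕ ] Σ[ a₄ ∈ ℕ ] Σ[ a₅ ∈ ℕ ] Σ[ a₆ ∈ ℕ ] Σ[ a₇ ∈ ℕ ]
      ( IsMin (RhoCan (2 ^ n) (G-NEQ (2 ^ n))) a₁
      × IsMin (RhoUltra (GenGrid (2 ^ n)) (G-NEQ (2 ^ n))) a₂
      × IsMin (RhoUltra (GenCube (n + n)) (NEQ n)) a₃
      × IsMin (ConondetSizeAND (NEQ n)) a₄
      × IsMin (NondetSizeOR (EQ n)) a₅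
      × IsMin (SizeOR (EQ n)) a₆
      × IsMin (SizeAND (NEQ n)) a₇ )
      × ( n ≤ a₁ × a₁ ≤ a₂ × a₂ ≤ a₃ × a₃ ≤ a₄ × a₄ ≤ a₅ × a₅ ≤ a₆ × a₆ ≤ a₇ × a₇ ≤ n )
      × a₅ ≡ n
corollary4p13 n@(suc k) (s≤s z≤n) =
  n , n , n , n , n , n , n ,
  ( (rhoCan-G-NEQ   , λ _ → rhoCan-G-NEQ⇒≤)
  , (rhoUltra-G-NEQ , λ _ → rhoUltra-G-NEQ⇒≤)
  , (rhoUltra-NEQ   , λ _ → rhoUltra-NEQ⇒≤)
  , (conondet , λ _ → nondetSizeOR-EQ⇒≤ ∘ conondetSizeAND⇒nondetSizeOR-not)
  , (nondet   , λ _ → nondetSizeOR-EQ⇒≤)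
  , (sizeOR   , λ _ → nondetSizeOR-EQ⇒≤ ∘ sizeOR⇒nondetSizeOR)
  , (sizeAND  , λ _ → nondetSizeOR-EQ⇒≤ ∘ sizeOR⇒nondetSizeOR ∘ sizeAND⇒sizeOR-not) ) ,
  (≤-refl , ≤-refl , ≤-refl , ≤-refl , ≤-refl , ≤-refl , ≤-refl , ≤-refl) ,
  refl
  where
  sizeAND : SizeAND (NEQ n) n
  sizeAND = sizeAND-NEQ k
  sizeOR : SizeOR (EQ n) n
  sizeOR = sizeAND⇒sizeOR-not sizeAND
  nondet : NondetSizeOR (EQ n) n
  nondet = sizeOR⇒nondetSizeOR sizeOR
  conondet : ConondetSizeAND (NEQ n) n
  conondet = nondetSizeOR-not⇒conondetSizeAND nondet
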